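{- As linear operators on $k\{\mathcal T\}$, $[\mathfrak P,\mathfrak N]=\mathfrak P\mathfrak N-\mathfrak N\mathfrak P=\mathfrak D$, where $\mathfrak D$ is the linear operator with $\mathfrak D(t)=|t|\,t$ for every rooted tree $t$.
   Context: A rooted tree is a finite partially ordered set (elements called vertices) with a unique greatest element, the root, such that for every vertex $v$ the set of vertices greater than $v$ is a chain; if $v$ covers $w$, $w$ is a child of $v$. We regard it as a directed graph with edges from each vertex to its children; a vertex is terminal if it has no children. Rooted trees are considered up to isomorphism; $\mathcal T$ is the set of finite rooted trees, $|t|$ the number of vertices of $t$, and $\bullet$ the one-vertex tree. Write $t\lhd t'$ if $t$ is obtained from $t'$ by deleting one terminal non-root vertex and the edge into it. For $t\lhd t'$, $n(t;t')$ is the number of vertices of $t$ at which attaching a new edge to a new terminal vertex yields $t'$, and $m(t;t')$ is the number of edges of $t'$ whose removal (with their terminal endpoint) leaves $t$. Let $k$ be a field of characteristic $0$ and $k\{\mathcal T\}$ the $k$-vector space with basis $\mathcal T$. The growth operator is the linear map $\mathfrak N(t)=\sum_{t\lhd t'}n(t;t')\,t'$; the pruning operator is the linear map $\mathfrak P(t)=\sum_{t'\lhd t}m(t';t)\,t'$ for $t\neq\bullet$, and $\mathfrak P(\bullet)=0$. -}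

module Defs where

open import Level using (Level; _⊔_) renaming (suc to lsuc)
open import Data.Bool using (Bool; true; false; if_then_else_; _∧_)
open import Data.Nat as ℕ using (ℕ; zero; suc)
open import Data.List using (List; []; _∷_; _++_; map; filterᵇ; length; deduplicateᵇ)
open import Data.List.Relation.Unary.Any using (Any)
open import Data.Product using (_×_; _,_; ∃)
open import Relation.Nullary using (¬_)
open import Relation.Binary.PropositionalEquality using (_≡_)
open import Algebra.Bundles using (CommutativeRing; Semiring)
import Algebra.Definitions.RawSemiring as RS

record Field (c ℓ : Level) : Set (lsuc (c ⊔ ℓ)) where
  field
    commutativeRing : CommutativeRing c ℓ
  open CommutativeRing commutativeRing public
  field
    0≉1     : ¬ (0# ≈ 1#)
    inverse : ∀ x → ¬ (x ≈ 0#) → ∃ λ y → (x * y) ≈ 1#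
  open RS (Semiring.rawSemiring semiring) public using () renaming (_×_ to _·1_)
  -- n ·1 x is the n-fold sum x + ... + x

Char0 : ∀ {c ℓ} → Field c ℓ → Set ℓ
Char0 F = ∀ n → ¬ ((suc n ·1 1#) ≈ 0#)
  where open Field F

-- A finite rooted tree is represented by a planar tree
-- (a root together with the list of its child subtrees); trees up to
-- isomorphism = planar trees up to reordering children at every vertex,
-- decided via a canonical form (children recursively sorted).

data Tree : Set where
  node : List Tree → Tree

∙ : Tree
∙ = node []

mutual
  size : Tree → ℕ
  size (node ts) = suc (sizeL ts)

  sizeL : List Tree → ℕ
  sizeL []       = 0
  sizeL (t ∷ ts) = size t ℕ.+ sizeL ts

data Ord3 : Set where lt eq gt : Ord3

mutual
  cmp : Tree → Tree → Ord3
  cmp (node xs) (node ys) = cmpL xs ys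

  cmpL : List Tree → List Tree → Ord3
  cmpL []       []       = eq
  cmpL []       (_ ∷ _)  = lt
  cmpL (_ ∷ _)  []       = gt
  cmpL (x ∷ xs) (y ∷ ys) = lex (cmp x y) xs ys

  lex : Ord3 → List Tree → List Tree → Ord3
  lex lt _  _  = lt
  lex gt _  _  = gt
  lex eq xs ys = cmpL xs ys

_≤ᵇT_ : Tree → Tree → Bool
s ≤ᵇT t with cmp s t
... | gt = false
... | _  = true

insertT : Tree → List Tree → List Tree
insertT x []       = x ∷ []
insertT x (y ∷ ys) = if x ≤ᵇT y then x ∷ y ∷ ys else y ∷ insertT x ys

sortT : List Tree → List Tree
sortT []       = []
sortT (x ∷ xs) = insertT x (sortT xs)

mutual
  canon : Tree → Tree
  canon (node ts) = node (sortT (canonL ts))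

  canonL : List Tree → List Tree
  canonL []       = []
  canonL (t ∷ ts) = canon t ∷ canonL ts

_==T_ : Tree → Tree → Bool
s ==T t with cmp s t
... | eq = true
... | _  = false

_≅_ : Tree → Tree → Set
s ≅ t = canon s ≡ canon t

_≅ᵇ_ : Tree → Tree → Bool
s ≅ᵇ t = canon s ==T canon t

leaf : Tree
leaf = ∙

-- grafts t : for every vertex v of t, the tree obtained by attaching a new
-- edge at v to a new terminal vertex (one list entry per vertex of t)
mutual
  grafts : Tree → List Tree
  grafts (node ts) = node (leaf ∷ ts) ∷ graftsL ts

  graftsL : List Tree → List Tree
  graftsL []       = []
  graftsL (t ∷ ts) = map (λ t' → node (t' ∷ ts)) (grafts t)
                  ++ map (λ { (node us) → node (t ∷ us) }) (graftsL ts)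

-- prunes t : for every terminal non-root vertex w of t, the tree obtained by
-- deleting w and the edge into it (one list entry per such vertex/edge)
mutual
  prunes : Tree → List Tree
  prunes (node ts) = prunesL ts

  prunesL : List Tree → List Tree
  prunesL []       = []
  prunesL (t ∷ ts) = here t ++ map (λ { (node us) → node (t ∷ us) }) (prunesL ts)
    where
    here : Tree → List Tree
    here (node [])        = node ts ∷ []
    here u@(node (_ ∷ _)) = map (λ u' → node (u' ∷ ts)) (prunes u)

countᵇ : (Tree → Bool) → List Tree → ℕ
countᵇ p xs = length (filterᵇ p xs)

_◁_ : Tree → Tree → Set
t ◁ t' = Any (λ u → u ≅ t) (prunes t')

nGr : Tree → Tree → ℕ
nGr t t' = countᵇ (λ u → u ≅ᵇ t') (grafts t)

mPr : Tree → Tree → ℕ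
mPr t t' = countᵇ (λ u → u ≅ᵇ t) (prunes t')

growClasses : Tree → List Tree
growClasses t = deduplicateᵇ _≅ᵇ_ (grafts t)

pruneClasses : Tree → List Tree
pruneClasses t = deduplicateᵇ _≅ᵇ_ (prunes t)

-- The vector space k{T} with basis the isomorphism classes of trees:
-- elements are finite formal sums Σ cᵢ tᵢ (lists of pairs), and two formal
-- sums are equal when they have the same coefficient at every tree s (the
-- coefficient at s being the sum of the cᵢ with tᵢ ≅ s).

module Vec {c ℓ} (F : Field c ℓ) where
  open Field F renaming (Carrier to K)

  V : Set c
  V = List (K × Tree)

  coeff : V → Tree → K
  coeff []             s = 0#
  coeff ((a , t) ∷ v)  s = (if t ≅ᵇ s then a else 0#) + coeff v s

  infix 4 _≈V_
  _≈V_ : V → V → Set ℓ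
  v ≈V w = ∀ s → coeff v s ≈ coeff w s

  scale : K → V → V
  scale a = map (λ { (b , t) → (a * b , t) })

  infixl 6 _−V_
  _−V_ : V → V → V
  v −V w = v ++ scale (- 1#) w

  lin : (Tree → V) → V → V
  lin f []            = []
  lin f ((a , t) ∷ v) = scale a (f t) ++ lin f v

  growT : Tree → V
  growT t = map (λ t' → (nGr t t' ·1 1# , t')) (growClasses t)

  pruneT : Tree → V
  pruneT (node [])       = []
  pruneT t@(node (_ ∷ _)) = map (λ t' → (mPr t' t ·1 1# , t')) (pruneClasses t)

  degT : Tree → V
  degT t = (size t ·1 1# , t) ∷ []

  𝔑 𝔓 𝔇 : V → V
  𝔑 = lin growT
  𝔓 = lin pruneT
  𝔇 = lin degT

{-# OPTIONS --safe #-}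

-- Coefficientwise, 𝔓𝔑 t counts the pairs (graft a new leaf at a vertex v of t, then prune a
-- terminal vertex x of the result), and 𝔑𝔓 t the pairs (prune a terminal vertex x of t, then
-- graft at a vertex v of what is left). Pruning the freshly grafted leaf gives back t, once for
-- each of the |t| choices of v; every other pair performs the same two operations as a pair of
-- the second kind, in the other order. So already for planar trees the two multisets of results
-- differ by |t| copies of t (∑-prunes∘grafts). What remains is to pass to isomorphism classes:
-- the multisets of classes of the grafts and of the prunes of a tree depend only on its class,
-- and 𝔑 t, 𝔓 t are these multisets grouped by class.

module Submission where

open import Defs

module Isomorphism where

  open import Data.Bool using (true; false; T; if_then_else_)
  open import Data.List using (List; []; _∷_; _++_; map)
  open import Data.List.Properties using (map-++; map-∘; map-cong)
  import Data.List.Relation.Binary.Pointwise as Pointwise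
  open import Data.List.Relation.Binary.Permutation.Propositional
    using (_↭_; prep; swap; ↭-sym; ↭-reflexive) renaming (refl to ↭-refl; trans to ↭-trans)
  open import Data.List.Relation.Binary.Permutation.Propositional.Properties using (map⁺)
  open import Data.Product using (∃₂; _,_)
  open import Data.Sum using (_⊎_; inj₁; inj₂)
  open import Data.Unit using (tt)
  open import Function using (_∘_; case_of_)
  open import Relation.Binary.Bundles using (DecTotalOrder; Setoid)
  open import Relation.Binary.Definitions using (DecidableEquality)
  open import Relation.Binary.PropositionalEquality
  open import Relation.Binary.Structures using (IsEquivalence)
  open import Relation.Nullary.Decidable using (T?; yes; no)

  flipOrd : Ord3 → Ord3
  flipOrd lt = gt
  flipOrd eq = eq
  flipOrd gt = lt

  mutual
    cmp-refl : ∀ t → cmp t t ≡ eq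
    cmp-refl (node ts) = cmpL-refl ts

    cmpL-refl : ∀ ts → cmpL ts ts ≡ eq
    cmpL-refl []       = refl
    cmpL-refl (t ∷ ts) rewrite cmp-refl t = cmpL-refl ts

  mutual
    cmp≡eq⇒≡ : ∀ s t → cmp s t ≡ eq → s ≡ t
    cmp≡eq⇒≡ (node ss) (node ts) e = cong node (cmpL≡eq⇒≡ ss ts e)

    cmpL≡eq⇒≡ : ∀ ss ts → cmpL ss ts ≡ eq → ss ≡ ts
    cmpL≡eq⇒≡ []       []       e = refl
    cmpL≡eq⇒≡ (s ∷ ss) (t ∷ ts) e with cmp s t in st
    ... | eq = cong₂ _∷_ (cmp≡eq⇒≡ s t st) (cmpL≡eq⇒≡ ss ts e)

  mutual
    cmp-flip : ∀ s t → cmp t s ≡ flipOrd (cmp s t)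
    cmp-flip (node ss) (node ts) = cmpL-flip ss ts

    cmpL-flip : ∀ ss ts → cmpL ts ss ≡ flipOrd (cmpL ss ts)
    cmpL-flip []       []       = refl
    cmpL-flip []       (t ∷ ts) = refl
    cmpL-flip (s ∷ ss) []       = refl
    cmpL-flip (s ∷ ss) (t ∷ ts) rewrite cmp-flip s t with cmp s t
    ... | lt = refl
    ... | eq = cmpL-flip ss ts
    ... | gt = refl

  mutual
    cmp-trans-lt : ∀ r s t → cmp r s ≡ lt → cmp s t ≡ lt → cmp r t ≡ lt
    cmp-trans-lt (node rs) (node ss) (node ts) = cmpL-trans-lt rs ss ts

    cmpL-trans-lt : ∀ rs ss ts → cmpL rs ss ≡ lt → cmpL ss ts ≡ lt → cmpL rs ts ≡ lt
    cmpL-trans-lt []       (s ∷ ss) (t ∷ ts) _ _ = refl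
    cmpL-trans-lt (r ∷ rs) (s ∷ ss) (t ∷ ts) e₁ e₂ with cmp r s in rs′ | cmp s t in st
    ... | lt | lt rewrite cmp-trans-lt r s t rs′ st = refl
    ... | lt | eq rewrite cmp≡eq⇒≡ s t st | rs′ = refl
    ... | eq | lt rewrite cmp≡eq⇒≡ r s rs′ | st = refl
    ... | eq | eq rewrite cmp≡eq⇒≡ r s rs′ | cmp≡eq⇒≡ s t st | cmp-refl t =
      cmpL-trans-lt rs ss ts e₁ e₂

  _≤T_ : Tree → Tree → Set
  s ≤T t = T (s ≤ᵇT t)

  ≤T-reflexive : ∀ {s t} → s ≡ t → s ≤T t
  ≤T-reflexive {s} refl rewrite cmp-refl s = tt

  ≤T-trans : ∀ {r s t} → r ≤T s → s ≤T t → r ≤T t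
  ≤T-trans {r} {s} {t} _ _ with cmp r s in rs | cmp s t in st
  ... | lt | lt rewrite cmp-trans-lt r s t rs st = tt
  ... | lt | eq rewrite cmp≡eq⇒≡ s t st | rs = tt
  ... | eq | lt rewrite cmp≡eq⇒≡ r s rs | st = tt
  ... | eq | eq rewrite cmp≡eq⇒≡ r s rs | cmp≡eq⇒≡ s t st | cmp-refl t = tt

  ≤T-antisym : ∀ {s t} → s ≤T t → t ≤T s → s ≡ t
  ≤T-antisym {s} {t} _ _ rewrite cmp-flip s t with cmp s t in st
  ... | eq = cmp≡eq⇒≡ s t st

  ≤T-total : ∀ s t → (s ≤T t) ⊎ (t ≤T s)
  ≤T-total s t rewrite cmp-flip s t with cmp s t
  ... | lt = inj₁ tt
  ... | eq = inj₁ tt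
  ... | gt = inj₂ tt

  _≟T_ : DecidableEquality Tree
  s ≟T t with cmp s t in st
  ... | eq = yes (cmp≡eq⇒≡ s t st)
  ... | lt = no λ { refl → case trans (sym st) (cmp-refl s) of λ () }
  ... | gt = no λ { refl → case trans (sym st) (cmp-refl s) of λ () }

  ≤T-decTotalOrder : DecTotalOrder _ _ _
  ≤T-decTotalOrder = record
    { Carrier         = Tree
    ; _≈_             = _≡_
    ; _≤_             = _≤T_
    ; isDecTotalOrder = record
      { isTotalOrder = record
        { isPartialOrder = record
          { isPreorder = record
            { isEquivalence = isEquivalence
            ; reflexive     = λ {s} {t} → ≤T-reflexive {s} {t}
            ; trans         = λ {r} {s} {t} → ≤T-trans {r} {s} {t}
            }
          ; antisym = λ {s} {t} → ≤T-antisym {s} {t}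
          }
        ; total = ≤T-total
        }
      ; _≟_  = _≟T_
      ; _≤?_ = λ s t → T? (s ≤ᵇT t)
      }
    }

  open import Data.List.Sort.InsertionSort.Base ≤T-decTotalOrder using (insert; sort)
  import Data.List.Sort.InsertionSort.Properties ≤T-decTotalOrder as InsertionSort

  insertT≡insert : ∀ t ts → insertT t ts ≡ insert t ts
  insertT≡insert t []       = refl
  insertT≡insert t (u ∷ us) =
    cong (if t ≤ᵇT u then t ∷ u ∷ us else_) (cong (u ∷_) (insertT≡insert t us))

  sortT≡sort : ∀ ts → sortT ts ≡ sort ts
  sortT≡sort []       = refl
  sortT≡sort (t ∷ ts) = trans (insertT≡insert t (sortT ts)) (cong (insert t) (sortT≡sort ts))

  sort-cong-↭ : ∀ {ss ts} → ss ↭ ts → sort ss ≡ sort ts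
  sort-cong-↭ ↭-refl                 = refl
  sort-cong-↭ (prep t p)             = cong (insert t) (sort-cong-↭ p)
  sort-cong-↭ (swap {_} {ts} s t p) =
    trans (cong (insert s ∘ insert t) (sort-cong-↭ p))
          (Pointwise.Pointwise-≡⇒≡ (InsertionSort.insert-swap s t (sort ts)))
  sort-cong-↭ (↭-trans p q)          = trans (sort-cong-↭ p) (sort-cong-↭ q)

  sortT-cong-↭ : ∀ {ss ts} → ss ↭ ts → sortT ss ≡ sortT ts
  sortT-cong-↭ {ss} {ts} p = trans (sortT≡sort ss) (trans (sort-cong-↭ p) (sym (sortT≡sort ts)))

  sortT-↭ : ∀ ts → sortT ts ↭ ts
  sortT-↭ ts = ↭-trans (↭-reflexive (sortT≡sort ts)) (InsertionSort.sort-↭ ts)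

  canonL≡map : ∀ ts → canonL ts ≡ map canon ts
  canonL≡map []       = refl
  canonL≡map (t ∷ ts) = cong (canon t ∷_) (canonL≡map ts)

  canon-cong-↭ : ∀ {ss ts} → ss ↭ ts → canon (node ss) ≡ canon (node ts)
  canon-cong-↭ {ss} {ts} p = cong node (begin
    sortT (canonL ss)    ≡⟨ cong sortT (canonL≡map ss) ⟩
    sortT (map canon ss) ≡⟨ sortT-cong-↭ (map⁺ canon p) ⟩
    sortT (map canon ts) ≡⟨ cong sortT (canonL≡map ts) ⟨
    sortT (canonL ts)    ∎)
    where open ≡-Reasoning

  mutual
    canon-idem : ∀ t → canon (canon t) ≡ canon t
    canon-idem (node ts) = trans (canon-cong-↭ (sortT-↭ (canonL ts))) (cong (node ∘ sortT) (canonL-idem ts))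

    canonL-idem : ∀ ts → canonL (canonL ts) ≡ canonL ts
    canonL-idem []       = refl
    canonL-idem (t ∷ ts) = cong₂ _∷_ (canon-idem t) (canonL-idem ts)

  ==T⇒≡ : ∀ s t → T (s ==T t) → s ≡ t
  ==T⇒≡ s t _ with cmp s t in st
  ... | eq = cmp≡eq⇒≡ s t st

  ≅ᵇ⇒≅ : ∀ s t → T (s ≅ᵇ t) → s ≅ t
  ≅ᵇ⇒≅ s t = ==T⇒≡ (canon s) (canon t)

  ≅⇒≅ᵇ : ∀ s t → s ≅ t → T (s ≅ᵇ t)
  ≅⇒≅ᵇ s t s≅t rewrite s≅t | cmp-refl (canon t) = tt

  ≅ᵇ-isEquivalence : IsEquivalence (λ s t → T (s ≅ᵇ t))
  ≅ᵇ-isEquivalence = record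
    { refl  = λ {t} → ≅⇒≅ᵇ t t refl
    ; sym   = λ {s} {t} e → ≅⇒≅ᵇ t s (sym (≅ᵇ⇒≅ s t e))
    ; trans = λ {r} {s} {t} e₁ e₂ → ≅⇒≅ᵇ r t (trans (≅ᵇ⇒≅ r s e₁) (≅ᵇ⇒≅ s t e₂))
    }

  -- _≅_ as a record, so that Agda can infer the two trees from a proof.
  infix 4 _≃_
  record _≃_ (s t : Tree) : Set where
    constructor mk≃
    field ≃⇒≅ : s ≅ t
  open _≃_

  ≃-isEquivalence : IsEquivalence _≃_
  ≃-isEquivalence = record
    { refl  = mk≃ refl
    ; sym   = λ s≃t → mk≃ (sym (≃⇒≅ s≃t))
    ; trans = λ r≃s s≃t → mk≃ (trans (≃⇒≅ r≃s) (≃⇒≅ s≃t))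
    }

  open IsEquivalence ≃-isEquivalence public using () renaming (refl to ≃-refl)

  ≃-setoid : Setoid _ _
  ≃-setoid = record { isEquivalence = ≃-isEquivalence }

  ≃-canon : ∀ t → t ≃ canon t
  ≃-canon t = mk≃ (sym (canon-idem t))

  node-≃-↭ : ∀ {ss ts} → ss ↭ ts → node ss ≃ node ts
  node-≃-↭ p = mk≃ (canon-cong-↭ p)

  node-≃-canonL : ∀ ts → node ts ≃ node (canonL ts)
  node-≃-canonL ts = mk≃ (cong (node ∘ sortT) (sym (canonL-idem ts)))

  addChild : Tree → Tree → Tree
  addChild a (node ts) = node (a ∷ ts)

  insertChild : Tree → Tree → Tree
  insertChild a (node ts) = node (insertT a ts)

  canon-addChild : ∀ a t → canon (addChild a t) ≡ insertChild (canon a) (canon t)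
  canon-addChild a (node ts) = refl

  addChild-cong : ∀ {a b s t} → a ≃ b → s ≃ t → addChild a s ≃ addChild b t
  addChild-cong {a} {b} {s} {t} (mk≃ a≅b) (mk≃ s≅t) = mk≃ (begin
    canon (addChild a s)            ≡⟨ canon-addChild a s ⟩
    insertChild (canon a) (canon s) ≡⟨ cong₂ insertChild a≅b s≅t ⟩
    insertChild (canon b) (canon t) ≡⟨ canon-addChild b t ⟨
    canon (addChild b t)            ∎)
    where open ≡-Reasoning

  addChild-comm : ∀ a b t → addChild a (addChild b t) ≃ addChild b (addChild a t)
  addChild-comm a b (node ts) = node-≃-↭ (swap a b (↭-refl {xs = ts}))

  NonLeaf : Tree → Set
  NonLeaf t = ∃₂ λ b bs → t ≡ node (b ∷ bs)

  canon-nonLeaf : ∀ a as → NonLeaf (canon (node (a ∷ as)))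
  canon-nonLeaf a as = insert-nonEmpty (canon a) (sortT (canonL as))
    where
    insert-nonEmpty : ∀ b bs → NonLeaf (node (insertT b bs))
    insert-nonEmpty b []       = b , [] , refl
    insert-nonEmpty b (c ∷ cs) with b ≤ᵇT c
    ... | true  = b , c ∷ cs , refl
    ... | false = c , insertT b cs , refl

  open import Data.List.Relation.Binary.Permutation.Setoid ≃-setoid public
    using () renaming (_↭_ to _≃ₘ_)
  open import Data.List.Relation.Binary.Permutation.Setoid ≃-setoid
    using ()
    renaming (refl to pointwise⇒≃ₘ; prep to ∷-≃ₘ; ↭-refl to ≃ₘ-refl; ↭-sym to ≃ₘ-sym; ↭-trans to ≃ₘ-trans)
  import Data.List.Relation.Binary.Permutation.Setoid.Properties ≃-setoid as ≃ₘ

  ≃ₘ-by-≡ : ∀ {L L′ M M′} → L ≡ L′ → M ≡ M′ → L′ ≃ₘ M′ → L ≃ₘ M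
  ≃ₘ-by-≡ refl refl p = p

  map-≃ₘ : ∀ {f g : Tree → Tree} → (∀ u → f u ≃ g u) → ∀ L → map f L ≃ₘ map g L
  map-≃ₘ {f} {g} f≃g L = pointwise⇒≃ₘ (Pointwise.map⁺ f g (Pointwise.refl (λ {u} → f≃g u)))

  map-cong-≃ₘ : ∀ {f : Tree → Tree} → (∀ {s t} → s ≃ t → f s ≃ f t) →
                ∀ {L M} → L ≃ₘ M → map f L ≃ₘ map f M
  map-cong-≃ₘ = ≃ₘ.map⁺ ≃-setoid

  map-addChild-comm-≃ₘ : ∀ s t {L M} → L ≃ₘ M →
                         map (addChild s ∘ addChild t) L ≃ₘ map (addChild t ∘ addChild s) M
  map-addChild-comm-≃ₘ s t {L} L≃M =
    ≃ₘ-trans (map-≃ₘ (addChild-comm s t) L)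
             (map-cong-≃ₘ (addChild-cong ≃-refl ∘ addChild-cong ≃-refl) L≃M)

  -- H t ts lists the results that lie inside the first tree t of the forest t ∷ ts.
  module _ (F : List Tree → List Tree) (H : Tree → List Tree → List Tree)
           (F-∷ : ∀ t ts → F (t ∷ ts) ≡ H t ts ++ map (addChild t) (F ts))
           (H-cong-↭ : ∀ t {xs ys} → xs ↭ ys → H t xs ≃ₘ H t ys)
           (H-swap : ∀ s t {xs ys} → xs ↭ ys → H s (t ∷ xs) ≃ₘ map (addChild t) (H s ys))
    where

    private
      F-∷∷ : ∀ s t ts →
        F (s ∷ t ∷ ts) ≡ H s (t ∷ ts) ++ map (addChild s) (H t ts) ++ map (addChild s ∘ addChild t) (F ts)
      F-∷∷ s t ts = begin
        F (s ∷ t ∷ ts)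
          ≡⟨ F-∷ s (t ∷ ts) ⟩
        H s (t ∷ ts) ++ map (addChild s) (F (t ∷ ts))
          ≡⟨ cong (λ L → H s (t ∷ ts) ++ map (addChild s) L) (F-∷ t ts) ⟩
        H s (t ∷ ts) ++ map (addChild s) (H t ts ++ map (addChild t) (F ts))
          ≡⟨ cong (H s (t ∷ ts) ++_) (map-++ (addChild s) (H t ts) (map (addChild t) (F ts))) ⟩
        H s (t ∷ ts) ++ map (addChild s) (H t ts) ++ map (addChild s) (map (addChild t) (F ts))
          ≡⟨ cong (λ L → H s (t ∷ ts) ++ map (addChild s) (H t ts) ++ L) (map-∘ (F ts)) ⟨
        H s (t ∷ ts) ++ map (addChild s) (H t ts) ++ map (addChild s ∘ addChild t) (F ts) ∎
        where open ≡-Reasoning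

    forest-cong-↭ : ∀ {xs ys} → xs ↭ ys → F xs ≃ₘ F ys
    forest-cong-↭ ↭-refl                 = ≃ₘ-refl
    forest-cong-↭ (prep {xs} {ys} t p)   =
      ≃ₘ-by-≡ (F-∷ t xs) (F-∷ t ys)
        (≃ₘ.++⁺ (H-cong-↭ t p) (map-cong-≃ₘ (addChild-cong ≃-refl) (forest-cong-↭ p)))
    forest-cong-↭ (swap {xs} {ys} s t p) =
      ≃ₘ-by-≡ (F-∷∷ s t xs) (F-∷∷ t s ys)
        (≃ₘ-trans (≃ₘ.++⁺ (H-swap s t p)
                  (≃ₘ.++⁺ (≃ₘ-sym (H-swap t s (↭-sym p)))
                          (map-addChild-comm-≃ₘ s t (forest-cong-↭ p))))
                  (≃ₘ.shifts (map (addChild t) (H s ys)) (H t (s ∷ ys))))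
    forest-cong-↭ (↭-trans p q)          = ≃ₘ-trans (forest-cong-↭ p) (forest-cong-↭ q)

  graftsL-∷ : ∀ t ts →
              graftsL (t ∷ ts) ≡ map (λ u → addChild u (node ts)) (grafts t) ++ map (addChild t) (graftsL ts)
  graftsL-∷ t ts =
    cong (map (λ u → addChild u (node ts)) (grafts t) ++_) (map-cong (λ { (node us) → refl }) (graftsL ts))

  graftsL-cong-↭ : ∀ {xs ys} → xs ↭ ys → graftsL xs ≃ₘ graftsL ys
  graftsL-cong-↭ = forest-cong-↭ graftsL (λ t ts → map (λ u → addChild u (node ts)) (grafts t)) graftsL-∷
    (λ t p → map-≃ₘ (λ u → node-≃-↭ (prep u p)) (grafts t))
    (λ s t p → ≃ₘ-by-≡ refl (sym (map-∘ (grafts s)))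
                        (map-≃ₘ (λ u → node-≃-↭ (swap u t p)) (grafts s)))

  mutual
    grafts-≃ₘ-canon : ∀ t → grafts t ≃ₘ grafts (canon t)
    grafts-≃ₘ-canon (node ts) =
      ∷-≃ₘ (addChild-cong ≃-refl (≃-canon (node ts)))
           (≃ₘ-trans (graftsL-≃ₘ-canonL ts) (graftsL-cong-↭ (↭-sym (sortT-↭ (canonL ts)))))

    graftsL-≃ₘ-canonL : ∀ ts → graftsL ts ≃ₘ graftsL (canonL ts)
    graftsL-≃ₘ-canonL []       = ≃ₘ-refl
    graftsL-≃ₘ-canonL (t ∷ ts) =
      ≃ₘ-by-≡ (graftsL-∷ t ts) (graftsL-∷ (canon t) (canonL ts))
        (≃ₘ.++⁺ (≃ₘ-trans (map-≃ₘ (λ _ → addChild-cong ≃-refl (node-≃-canonL ts)) (grafts t))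
                          (map-cong-≃ₘ (λ u≃v → addChild-cong u≃v ≃-refl) (grafts-≃ₘ-canon t)))
                (≃ₘ-trans (map-≃ₘ (λ _ → addChild-cong (≃-canon t) ≃-refl) (graftsL ts))
                          (map-cong-≃ₘ (addChild-cong ≃-refl) (graftsL-≃ₘ-canonL ts))))

  grafts-cong : ∀ {s t} → s ≃ t → grafts s ≃ₘ grafts t
  grafts-cong {s} {t} (mk≃ s≅t) =
    ≃ₘ-trans (grafts-≃ₘ-canon s) (≃ₘ-by-≡ (cong grafts s≅t) refl (≃ₘ-sym (grafts-≃ₘ-canon t)))

  prunesHead : Tree → List Tree → List Tree
  prunesHead (node [])        ts = node ts ∷ []
  prunesHead t@(node (_ ∷ _)) ts = map (λ u → addChild u (node ts)) (prunes t)

  prunesHead-nonLeaf : ∀ {t} → NonLeaf t →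
                       ∀ ts → prunesHead t ts ≡ map (λ u → addChild u (node ts)) (prunes t)
  prunesHead-nonLeaf (_ , _ , refl) ts = refl

  prunesL-∷ : ∀ t ts → prunesL (t ∷ ts) ≡ prunesHead t ts ++ map (addChild t) (prunesL ts)
  prunesL-∷ (node [])       ts = cong (node ts ∷_) (map-cong (λ { (node us) → refl }) (prunesL ts))
  prunesL-∷ (node (a ∷ as)) ts =
    cong (prunesHead (node (a ∷ as)) ts ++_) (map-cong (λ { (node us) → refl }) (prunesL ts))

  prunesL-cong-↭ : ∀ {xs ys} → xs ↭ ys → prunesL xs ≃ₘ prunesL ys
  prunesL-cong-↭ = forest-cong-↭ prunesL prunesHead prunesL-∷ prunesHead-cong-↭ prunesHead-swap
    where
    prunesHead-cong-↭ : ∀ t {xs ys} → xs ↭ ys → prunesHead t xs ≃ₘ prunesHead t ys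
    prunesHead-cong-↭ (node [])        p = ∷-≃ₘ (node-≃-↭ p) ≃ₘ-refl
    prunesHead-cong-↭ t@(node (_ ∷ _)) p = map-≃ₘ (λ u → node-≃-↭ (prep u p)) (prunes t)

    prunesHead-swap : ∀ s t {xs ys} → xs ↭ ys →
                      prunesHead s (t ∷ xs) ≃ₘ map (addChild t) (prunesHead s ys)
    prunesHead-swap (node [])        t p = ∷-≃ₘ (node-≃-↭ (prep t p)) ≃ₘ-refl
    prunesHead-swap s@(node (_ ∷ _)) t p =
      ≃ₘ-by-≡ refl (sym (map-∘ (prunes s))) (map-≃ₘ (λ u → node-≃-↭ (swap u t p)) (prunes s))

  mutual
    prunes-≃ₘ-canon : ∀ t → prunes t ≃ₘ prunes (canon t)
    prunes-≃ₘ-canon (node ts) =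
      ≃ₘ-trans (prunesL-≃ₘ-canonL ts) (prunesL-cong-↭ (↭-sym (sortT-↭ (canonL ts))))

    prunesL-≃ₘ-canonL : ∀ ts → prunesL ts ≃ₘ prunesL (canonL ts)
    prunesL-≃ₘ-canonL []       = ≃ₘ-refl
    prunesL-≃ₘ-canonL (t ∷ ts) =
      ≃ₘ-by-≡ (prunesL-∷ t ts) (prunesL-∷ (canon t) (canonL ts))
        (≃ₘ.++⁺ (prunesHead-≃ₘ-canon t ts)
                (≃ₘ-trans (map-≃ₘ (λ _ → addChild-cong (≃-canon t) ≃-refl) (prunesL ts))
                          (map-cong-≃ₘ (addChild-cong ≃-refl) (prunesL-≃ₘ-canonL ts))))

    prunesHead-≃ₘ-canon : ∀ t ts → prunesHead t ts ≃ₘ prunesHead (canon t) (canonL ts)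
    prunesHead-≃ₘ-canon (node [])         ts = ∷-≃ₘ (node-≃-canonL ts) ≃ₘ-refl
    prunesHead-≃ₘ-canon t@(node (a ∷ as)) ts =
      ≃ₘ-by-≡ refl (prunesHead-nonLeaf (canon-nonLeaf a as) (canonL ts))
        (≃ₘ-trans (map-≃ₘ (λ _ → addChild-cong ≃-refl (node-≃-canonL ts)) (prunes t))
                  (map-cong-≃ₘ (λ u≃v → addChild-cong u≃v ≃-refl) (prunes-≃ₘ-canon t)))

  prunes-cong : ∀ {s t} → s ≃ t → prunes s ≃ₘ prunes t
  prunes-cong {s} {t} (mk≃ s≅t) =
    ≃ₘ-trans (prunes-≃ₘ-canon s) (≃ₘ-by-≡ (cong prunes s≅t) refl (≃ₘ-sym (prunes-≃ₘ-canon t)))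

module Sums where

  open import Data.Bool using (Bool; true; false; T; not; if_then_else_)
  open import Data.Empty using (⊥-elim)
  open import Data.List using (List; []; _∷_; _++_; map; length; filter; filterᵇ; deduplicateᵇ)
  open import Data.List.Properties using (map-++; map-∘; map-cong; map-cong-local)
  open import Data.List.Relation.Unary.All as All using (All)
  open import Data.List.Relation.Unary.Any as Any using (Any; here; there)
  open import Data.Nat using (ℕ; suc; _+_; _*_)
  open import Data.Nat.ListAction using (sum)
  open import Data.Nat.ListAction.Properties using (sum-++)
  open import Data.Nat.Properties using (*-distribʳ-+; +-identityʳ; +-commutativeSemigroup)
  open import Algebra.Properties.CommutativeSemigroup +-commutativeSemigroup using (interchange)
  open import Data.Unit using (tt)
  open import Function using (_∘_)
  open import Relation.Binary.PropositionalEquality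
  open import Relation.Binary.Structures using (IsEquivalence)
  open import Relation.Nullary.Decidable using (does)
  import Relation.Unary as U

  private variable
    A B : Set

  ∑ : (A → ℕ) → List A → ℕ
  ∑ f xs = sum (map f xs)

  ∑-++ : ∀ (f : A → ℕ) xs ys → ∑ f (xs ++ ys) ≡ ∑ f xs + ∑ f ys
  ∑-++ f xs ys = trans (cong sum (map-++ f xs ys)) (sum-++ (map f xs) (map f ys))

  ∑-map : ∀ (f : A → ℕ) (g : B → A) xs → ∑ f (map g xs) ≡ ∑ (f ∘ g) xs
  ∑-map f g xs = cong sum (sym (map-∘ xs))

  ∑-cong : ∀ {f g : A → ℕ} → (∀ x → f x ≡ g x) → ∀ xs → ∑ f xs ≡ ∑ g xs
  ∑-cong f≗g xs = cong sum (map-cong f≗g xs)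

  ∑-cong-All : ∀ {f g : A → ℕ} {xs} → All (λ x → f x ≡ g x) xs → ∑ f xs ≡ ∑ g xs
  ∑-cong-All = cong sum ∘ map-cong-local

  ∑-+ : ∀ (f g : A → ℕ) xs → ∑ (λ x → f x + g x) xs ≡ ∑ f xs + ∑ g xs
  ∑-+ f g []       = refl
  ∑-+ f g (x ∷ xs) = trans (cong (f x + g x +_) (∑-+ f g xs)) (interchange (f x) (g x) (∑ f xs) (∑ g xs))

  ∑-zero : ∀ (xs : List A) → ∑ (λ _ → 0) xs ≡ 0
  ∑-zero []       = refl
  ∑-zero (x ∷ xs) = ∑-zero xs

  ∑-comm : ∀ (h : A → B → ℕ) xs ys →
           ∑ (λ x → ∑ (h x) ys) xs ≡ ∑ (λ y → ∑ (λ x → h x y) xs) ys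
  ∑-comm h []       ys = sym (∑-zero ys)
  ∑-comm h (x ∷ xs) ys =
    trans (cong (∑ (h x) ys +_) (∑-comm h xs ys)) (sym (∑-+ (h x) (λ y → ∑ (λ x → h x y) xs) ys))

  ∑-*ʳ : ∀ (f : A → ℕ) k xs → ∑ (λ x → f x * k) xs ≡ ∑ f xs * k
  ∑-*ʳ f k []       = refl
  ∑-*ʳ f k (x ∷ xs) = trans (cong (f x * k +_) (∑-*ʳ f k xs)) (sym (*-distribʳ-+ k (f x) (∑ f xs)))

  χ : Bool → ℕ
  χ true  = 1
  χ false = 0

  length-filterᵇ : ∀ (p : A → Bool) xs → length (filterᵇ p xs) ≡ ∑ (χ ∘ p) xs
  length-filterᵇ p []       = refl
  length-filterᵇ p (x ∷ xs) with p x
  ... | true  = cong suc (length-filterᵇ p xs)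
  ... | false = length-filterᵇ p xs

  ∑-filter : ∀ {P : A → Set} (P? : U.Decidable P) (g : A → ℕ) xs →
             ∑ g (filter P? xs) ≡ ∑ (λ x → if does (P? x) then g x else 0) xs
  ∑-filter P? g []       = refl
  ∑-filter P? g (x ∷ xs) with does (P? x)
  ... | true  = cong (g x +_) (∑-filter P? g xs)
  ... | false = ∑-filter P? g xs

  module _ (r : A → A → Bool) (r-isEquivalence : IsEquivalence (λ x y → T (r x y))) where

    open IsEquivalence r-isEquivalence renaming (refl to r-refl; sym to r-sym; trans to r-trans)

    private
      ≡true⇒T : ∀ {b} → b ≡ true → T b
      ≡true⇒T refl = tt

    ∑-χ-deduplicateᵇ : ∀ x ys → Any (λ y → T (r x y)) ys →
                       ∑ (λ c → χ (r x c)) (deduplicateᵇ r ys) ≡ 1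
    ∑-χ-deduplicateᵇ x (y ∷ ys) x~ys with r x y in xy
    ... | true  = cong suc (begin
      ∑ (λ c → χ (r x c)) (filter _ reps)                 ≡⟨ ∑-filter _ _ reps ⟩
      ∑ (λ c → if not (r y c) then χ (r x c) else 0) reps ≡⟨ ∑-cong dropped reps ⟩
      ∑ (λ _ → 0) reps                                     ≡⟨ ∑-zero reps ⟩
      0                                                     ∎)
      where
      open ≡-Reasoning
      reps = deduplicateᵇ r ys
      dropped : ∀ c → (if not (r y c) then χ (r x c) else 0) ≡ 0
      dropped c with r y c in yc | r x c in xc
      ... | true  | _     = refl
      ... | false | false = refl
      ... | false | true  = ⊥-elim (subst T yc (r-trans (r-sym (≡true⇒T xy)) (≡true⇒T xc)))
    ... | false = begin
      ∑ (λ c → χ (r x c)) (filter _ reps)                 ≡⟨ ∑-filter _ _ reps ⟩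
      ∑ (λ c → if not (r y c) then χ (r x c) else 0) reps ≡⟨ ∑-cong kept reps ⟩
      ∑ (λ c → χ (r x c)) reps                             ≡⟨ ∑-χ-deduplicateᵇ x ys (tail x~ys) ⟩
      1                                                     ∎
      where
      open ≡-Reasoning
      reps = deduplicateᵇ r ys
      kept : ∀ c → (if not (r y c) then χ (r x c) else 0) ≡ χ (r x c)
      kept c with r y c in yc | r x c in xc
      ... | false | _     = refl
      ... | true  | false = refl
      ... | true  | true  = ⊥-elim (subst T xy (r-trans (≡true⇒T xc) (r-sym (≡true⇒T yc))))
      tail : Any (λ z → T (r x z)) (y ∷ ys) → Any (λ z → T (r x z)) ys
      tail (here x~y)   = ⊥-elim (subst T xy x~y)
      tail (there x~ys) = x~ys

    ∑-deduplicateᵇ : ∀ (f : A → ℕ) → (∀ {x y} → T (r x y) → f x ≡ f y) → ∀ xs →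
                     ∑ (λ c → length (filterᵇ (λ x → r x c) xs) * f c) (deduplicateᵇ r xs) ≡ ∑ f xs
    ∑-deduplicateᵇ f f-cong xs = begin
      ∑ (λ c → length (filterᵇ (λ x → r x c) xs) * f c) reps
        ≡⟨ ∑-cong (λ c → cong (_* f c) (length-filterᵇ (λ x → r x c) xs)) reps ⟩
      ∑ (λ c → ∑ (λ x → χ (r x c)) xs * f c) reps
        ≡⟨ ∑-cong (λ c → ∑-*ʳ (λ x → χ (r x c)) (f c) xs) reps ⟨
      ∑ (λ c → ∑ (λ x → χ (r x c) * f c) xs) reps
        ≡⟨ ∑-comm (λ c x → χ (r x c) * f c) reps xs ⟩
      ∑ (λ x → ∑ (λ c → χ (r x c) * f c) reps) xs
        ≡⟨ ∑-cong (λ x → ∑-cong (χ-* x) reps) xs ⟩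
      ∑ (λ x → ∑ (λ c → χ (r x c) * f x) reps) xs
        ≡⟨ ∑-cong (λ x → ∑-*ʳ (λ c → χ (r x c)) (f x) reps) xs ⟩
      ∑ (λ x → ∑ (λ c → χ (r x c)) reps * f x) xs
        ≡⟨ ∑-cong-All (All.tabulate λ x∈xs →
             cong (_* f _) (∑-χ-deduplicateᵇ _ xs (Any.map (λ { refl → r-refl }) x∈xs))) ⟩
      ∑ (λ x → 1 * f x) xs
        ≡⟨ ∑-cong (λ x → +-identityʳ (f x)) xs ⟩
      ∑ f xs ∎
      where
      open ≡-Reasoning
      reps = deduplicateᵇ r xs
      χ-* : ∀ x c → χ (r x c) * f c ≡ χ (r x c) * f x
      χ-* x c with r x c in xc
      ... | true  = cong (_+ 0) (f-cong (r-sym (≡true⇒T xc)))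
      ... | false = refl

module GraftingAndPruning where

  open Isomorphism
  open Sums
  open import Data.List using (List; []; _∷_; _++_; map)
  import Data.List.Relation.Binary.Permutation.Setoid.Properties ≃-setoid as ≃ₘ
  open import Data.List.Relation.Binary.Permutation.Propositional using (↭ₛ⇒↭)
  open import Data.List.Relation.Unary.All as All using (All; _∷_)
  import Data.List.Relation.Unary.All.Properties as All
  open import Data.Nat using (ℕ; suc; _+_; _*_)
  open import Data.Nat.ListAction.Properties using (sum-↭)
  open import Data.Nat.Properties using (+-identityʳ)
  open import Data.Nat.Tactic.RingSolver using (solve-∀)
  open import Data.Product using (_,_)
  open import Function using (_∘_)
  open import Relation.Binary.PropositionalEquality

  ∑-cong-≃ₘ : ∀ {f : Tree → ℕ} → (∀ {s t} → s ≃ t → f s ≡ f t) →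
              ∀ {L M} → L ≃ₘ M → ∑ f L ≡ ∑ f M
  ∑-cong-≃ₘ f-cong p = sum-↭ (↭ₛ⇒↭ (≃ₘ.map⁺ (setoid ℕ) f-cong p))

  children : Tree → List Tree
  children (node ts) = ts

  graftsBelow : Tree → List Tree
  graftsBelow (node ts) = graftsL ts

  grafts-nonLeaf : ∀ t → All NonLeaf (grafts t)
  grafts-nonLeaf (node ts) = (leaf , ts , refl) ∷ graftsL-nonLeaf ts
    where
    graftsL-nonLeaf : ∀ ts → All NonLeaf (graftsL ts)
    graftsL-nonLeaf []       = All.[]
    graftsL-nonLeaf (t ∷ ts) rewrite graftsL-∷ t ts =
      All.++⁺ (All.map⁺ (All.universal (λ u → u , ts , refl) (grafts t)))
              (All.map⁺ (All.universal (λ { (node us) → t , us , refl }) (graftsL ts)))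

  ∑-grafts : ∀ (F : Tree → ℕ) t → ∑ F (grafts t) ≡ F (addChild leaf t) + ∑ F (graftsBelow t)
  ∑-grafts F (node ts) = refl

  ∑-graftsBelow-addChild : ∀ (F : Tree → ℕ) t q →
    ∑ F (graftsBelow (addChild t q))
      ≡ ∑ (λ u → F (addChild u q)) (grafts t) + ∑ (F ∘ addChild t) (graftsBelow q)
  ∑-graftsBelow-addChild F t q@(node us) = begin
    ∑ F (graftsL (t ∷ us))
      ≡⟨ cong (∑ F) (graftsL-∷ t us) ⟩
    ∑ F (map (λ u → addChild u q) (grafts t) ++ map (addChild t) (graftsL us))
      ≡⟨ ∑-++ F (map (λ u → addChild u q) (grafts t)) (map (addChild t) (graftsL us)) ⟩
    ∑ F (map (λ u → addChild u q) (grafts t)) + ∑ F (map (addChild t) (graftsL us))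
      ≡⟨ cong₂ _+_ (∑-map F (λ u → addChild u q) (grafts t)) (∑-map F (addChild t) (graftsL us)) ⟩
    ∑ (λ u → F (addChild u q)) (grafts t) + ∑ (F ∘ addChild t) (graftsL us) ∎
    where open ≡-Reasoning

  ∑-prunes-addChild : ∀ (F : Tree → ℕ) t q →
    ∑ F (prunes (addChild t q)) ≡ ∑ F (prunesHead t (children q)) + ∑ (F ∘ addChild t) (prunes q)
  ∑-prunes-addChild F t (node us) = begin
    ∑ F (prunesL (t ∷ us))
      ≡⟨ cong (∑ F) (prunesL-∷ t us) ⟩
    ∑ F (prunesHead t us ++ map (addChild t) (prunesL us))
      ≡⟨ ∑-++ F (prunesHead t us) (map (addChild t) (prunesL us)) ⟩
    ∑ F (prunesHead t us) + ∑ F (map (addChild t) (prunesL us))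
      ≡⟨ cong (∑ F (prunesHead t us) +_) (∑-map F (addChild t) (prunesL us)) ⟩
    ∑ F (prunesHead t us) + ∑ (F ∘ addChild t) (prunesL us) ∎
    where open ≡-Reasoning

  ∑-prunes-addChild-nonLeaf : ∀ (F : Tree → ℕ) {t} → NonLeaf t → ∀ q →
    ∑ F (prunes (addChild t q)) ≡ ∑ (λ w → F (addChild w q)) (prunes t) + ∑ (F ∘ addChild t) (prunes q)
  ∑-prunes-addChild-nonLeaf F {t} t-nonLeaf q@(node us) =
    trans (∑-prunes-addChild F t q)
          (cong (_+ ∑ (F ∘ addChild t) (prunes q))
                (trans (cong (∑ F) (prunesHead-nonLeaf t-nonLeaf us)) (∑-map F (λ w → addChild w q) (prunes t))))

  ∑-graftsBelow-prunesHead : ∀ (F : Tree → ℕ) t ts →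
    ∑ (∑ F ∘ graftsBelow) (prunesHead t ts)
      ≡ ∑ (λ p → ∑ (λ x → F (addChild x (node ts))) (grafts p)) (prunes t)
        + ∑ (λ q → ∑ F (prunesHead t (children q))) (graftsL ts)
  ∑-graftsBelow-prunesHead F (node []) ts =
    trans (+-identityʳ _) (∑-cong (λ { (node us) → sym (+-identityʳ (F (node us))) }) (graftsL ts))
  ∑-graftsBelow-prunesHead F t@(node (_ ∷ _)) ts = begin
    ∑ (∑ F ∘ graftsBelow) (map (λ w → addChild w (node ts)) (prunes t))
      ≡⟨ ∑-map (∑ F ∘ graftsBelow) (λ w → addChild w (node ts)) (prunes t) ⟩
    ∑ (λ w → ∑ F (graftsBelow (addChild w (node ts)))) (prunes t)
      ≡⟨ ∑-cong (λ w → ∑-graftsBelow-addChild F w (node ts)) (prunes t) ⟩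
    ∑ (λ w → inHead w + ∑ (F ∘ addChild w) (graftsL ts)) (prunes t)
      ≡⟨ ∑-+ inHead (λ w → ∑ (F ∘ addChild w) (graftsL ts)) (prunes t) ⟩
    ∑ inHead (prunes t) + ∑ (λ w → ∑ (F ∘ addChild w) (graftsL ts)) (prunes t)
      ≡⟨ cong (∑ inHead (prunes t) +_) (∑-comm (λ w → F ∘ addChild w) (prunes t) (graftsL ts)) ⟩
    ∑ inHead (prunes t) + ∑ (λ q → ∑ (λ w → F (addChild w q)) (prunes t)) (graftsL ts)
      ≡⟨ cong (∑ inHead (prunes t) +_)
              (∑-cong (λ { q@(node us) → sym (∑-map F (λ w → addChild w q) (prunes t)) }) (graftsL ts)) ⟩
    ∑ inHead (prunes t) + ∑ (λ q → ∑ F (prunesHead t (children q))) (graftsL ts) ∎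
    where
    open ≡-Reasoning
    inHead = λ w → ∑ (λ x → F (addChild x (node ts))) (grafts w)

  private
    regroup-root : ∀ f s a b → (f + 0 + a) + (s * f + b) ≡ suc s * f + (a + b)
    regroup-root = solve-∀

    regroup-forest : ∀ f m x₂ x₃ x₄ n x₆ →
      ((m * f + x₂) + x₃) + (x₄ + (n * f + x₆)) ≡ (m + n) * f + ((x₂ + x₄) + (x₃ + x₆))
    regroup-forest = solve-∀

  mutual
    ∑-prunes∘grafts : ∀ (F : Tree → ℕ) t →
                      ∑ (∑ F ∘ prunes) (grafts t) ≡ size t * F t + ∑ (∑ F ∘ grafts) (prunes t)
    ∑-prunes∘grafts F t@(node ts) = begin
      ∑ F (prunes (addChild leaf t)) + ∑ (∑ F ∘ prunes) (graftsL ts)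
        ≡⟨ cong₂ _+_ (∑-prunes-addChild F leaf t) (∑-prunes∘graftsL F ts) ⟩
      (F t + 0 + ∑ (F ∘ addChild leaf) (prunesL ts)) + (sizeL ts * F t + ∑ (∑ F ∘ graftsBelow) (prunesL ts))
        ≡⟨ regroup-root (F t) (sizeL ts) _ _ ⟩
      size t * F t + (∑ (F ∘ addChild leaf) (prunesL ts) + ∑ (∑ F ∘ graftsBelow) (prunesL ts))
        ≡⟨ cong (size t * F t +_) (∑-+ (F ∘ addChild leaf) (∑ F ∘ graftsBelow) (prunesL ts)) ⟨
      size t * F t + ∑ (λ p → F (addChild leaf p) + ∑ F (graftsBelow p)) (prunesL ts)
        ≡⟨ cong (size t * F t +_) (∑-cong (λ p → sym (∑-grafts F p)) (prunesL ts)) ⟩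
      size t * F t + ∑ (∑ F ∘ grafts) (prunesL ts) ∎
      where open ≡-Reasoning

    ∑-prunes∘graftsL : ∀ (F : Tree → ℕ) ts →
      ∑ (∑ F ∘ prunes) (graftsL ts) ≡ sizeL ts * F (node ts) + ∑ (∑ F ∘ graftsBelow) (prunesL ts)
    ∑-prunes∘graftsL F []       = refl
    ∑-prunes∘graftsL F (t ∷ ts) = begin
      ∑ (∑ F ∘ prunes) (graftsL (t ∷ ts))
        ≡⟨ graftThenPrune ⟩
      ((size t * f + x₂) + x₃) + (x₄ + (sizeL ts * f + x₆))
        ≡⟨ regroup-forest f (size t) x₂ x₃ x₄ (sizeL ts) x₆ ⟩
      (size t + sizeL ts) * f + ((x₂ + x₄) + (x₃ + x₆))
        ≡⟨ cong ((size t + sizeL ts) * f +_) pruneThenGraft ⟨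
      (size t + sizeL ts) * f + ∑ (∑ F ∘ graftsBelow) (prunesL (t ∷ ts)) ∎
      where
      open ≡-Reasoning
      Q  = node ts
      f  = F (node (t ∷ ts))
      x₂ = ∑ (λ p → ∑ (λ x → F (addChild x Q)) (grafts p)) (prunes t)
      x₃ = ∑ (λ p → ∑ (λ u → F (addChild u p)) (grafts t)) (prunesL ts)
      x₄ = ∑ (λ q → ∑ F (prunesHead t (children q))) (graftsL ts)
      x₆ = ∑ (λ p → ∑ (F ∘ addChild t) (graftsBelow p)) (prunesL ts)

      graftThenPrune :
        ∑ (∑ F ∘ prunes) (graftsL (t ∷ ts)) ≡ ((size t * f + x₂) + x₃) + (x₄ + (sizeL ts * f + x₆))
      graftThenPrune = begin
        ∑ (∑ F ∘ prunes) (graftsBelow (addChild t Q))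
          ≡⟨ ∑-graftsBelow-addChild (∑ F ∘ prunes) t Q ⟩
        ∑ (λ u → ∑ F (prunes (addChild u Q))) (grafts t) + ∑ (∑ F ∘ prunes ∘ addChild t) (graftsL ts)
          ≡⟨ cong₂ _+_ (∑-cong-All (All.map (λ nonLeaf → ∑-prunes-addChild-nonLeaf F nonLeaf Q)
                                            (grafts-nonLeaf t)))
                       (∑-cong (∑-prunes-addChild F t) (graftsL ts)) ⟩
        ∑ (λ u → inHead u + ∑ (F ∘ addChild u) (prunesL ts)) (grafts t)
          + ∑ (λ q → ∑ F (prunesHead t (children q)) + inTail q) (graftsL ts)
          ≡⟨ cong₂ _+_ (∑-+ inHead (λ u → ∑ (F ∘ addChild u) (prunesL ts)) (grafts t))
                       (∑-+ (λ q → ∑ F (prunesHead t (children q))) inTail (graftsL ts)) ⟩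
        (∑ inHead (grafts t) + ∑ (λ u → ∑ (F ∘ addChild u) (prunesL ts)) (grafts t))
          + (x₄ + ∑ inTail (graftsL ts))
          ≡⟨ cong₂ _+_ (cong₂ _+_ (∑-prunes∘grafts (λ w → F (addChild w Q)) t)
                                  (∑-comm (λ u → F ∘ addChild u) (grafts t) (prunesL ts)))
                       (cong (x₄ +_) (∑-prunes∘graftsL (F ∘ addChild t) ts)) ⟩
        ((size t * f + x₂) + x₃) + (x₄ + (sizeL ts * f + x₆)) ∎
        where
        inHead = λ u → ∑ (λ w → F (addChild w Q)) (prunes u)
        inTail = λ q → ∑ (F ∘ addChild t) (prunes q)

      pruneThenGraft : ∑ (∑ F ∘ graftsBelow) (prunesL (t ∷ ts)) ≡ (x₂ + x₄) + (x₃ + x₆)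
      pruneThenGraft = begin
        ∑ (∑ F ∘ graftsBelow) (prunes (addChild t Q))
          ≡⟨ ∑-prunes-addChild (∑ F ∘ graftsBelow) t Q ⟩
        ∑ (∑ F ∘ graftsBelow) (prunesHead t ts) + ∑ (∑ F ∘ graftsBelow ∘ addChild t) (prunesL ts)
          ≡⟨ cong (_+ ∑ (∑ F ∘ graftsBelow ∘ addChild t) (prunesL ts))
                  (∑-graftsBelow-prunesHead F t ts) ⟩
        (x₂ + x₄) + ∑ (λ p → ∑ F (graftsBelow (addChild t p))) (prunesL ts)
          ≡⟨ cong ((x₂ + x₄) +_) (∑-cong (∑-graftsBelow-addChild F t) (prunesL ts)) ⟩
        (x₂ + x₄) + ∑ (λ p → inHead′ p + ∑ (F ∘ addChild t) (graftsBelow p)) (prunesL ts)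
          ≡⟨ cong ((x₂ + x₄) +_)
                  (∑-+ inHead′ (λ p → ∑ (F ∘ addChild t) (graftsBelow p)) (prunesL ts)) ⟩
        (x₂ + x₄) + (x₃ + x₆) ∎
        where inHead′ = λ p → ∑ (λ u → F (addChild u p)) (grafts t)

module Operators {c ℓ} (k : Field c ℓ) where

  open Isomorphism
  open Sums
  open GraftingAndPruning
  open Field k renaming (Carrier to K)
  open Vec k
  open import Algebra.Properties.AbelianGroup +-abelianGroup using (xyx⁻¹≈y)
  open import Algebra.Properties.CommutativeSemigroup +-commutativeSemigroup using (interchange)
  open import Algebra.Properties.Ring ring using (-1*x≈-x)
  open import Algebra.Properties.Semiring.Mult semiring using (×-homo-+; ×-homo-1; ×1-homo-*)
  open import Data.Bool using (true; false; if_then_else_)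
  open import Data.List using (List; []; _∷_; _++_; map; deduplicateᵇ)
  open import Data.Nat as ℕ using (ℕ)
  import Data.Nat.Properties as ℕ
  open import Data.Product using (_,_)
  open import Function using (_∘_)
  import Relation.Binary.PropositionalEquality as ≡
  open import Relation.Binary.Reasoning.Setoid setoid

  ι : ℕ → K
  ι n = n ·1 1#

  pair : V → (Tree → K) → K
  pair []            φ = 0#
  pair ((a , t) ∷ v) φ = a * φ t + pair v φ

  pair-cong : ∀ v {φ ψ} → (∀ t → φ t ≈ ψ t) → pair v φ ≈ pair v ψ
  pair-cong []            φ≈ψ = refl
  pair-cong ((a , t) ∷ v) φ≈ψ = +-cong (*-congˡ (φ≈ψ t)) (pair-cong v φ≈ψ)

  pair-+ : ∀ v φ ψ → pair v (λ t → φ t + ψ t) ≈ pair v φ + pair v ψ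
  pair-+ []            φ ψ = sym (+-identityˡ 0#)
  pair-+ ((a , t) ∷ v) φ ψ = trans (+-cong (distribˡ a (φ t) (ψ t)) (pair-+ v φ ψ)) (interchange _ _ _ _)

  pair-++ : ∀ v w φ → pair (v ++ w) φ ≈ pair v φ + pair w φ
  pair-++ []            w φ = sym (+-identityˡ _)
  pair-++ ((a , t) ∷ v) w φ = trans (+-congˡ (pair-++ v w φ)) (sym (+-assoc _ _ _))

  pair-scale : ∀ a v φ → pair (scale a v) φ ≈ a * pair v φ
  pair-scale a []            φ = sym (zeroʳ a)
  pair-scale a ((b , t) ∷ v) φ = trans (+-cong (*-assoc a b (φ t)) (pair-scale a v φ)) (sym (distribˡ a _ _))

  pair-lin : ∀ f v φ → pair (lin f v) φ ≈ pair v (λ t → pair (f t) φ)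
  pair-lin f []            φ = refl
  pair-lin f ((a , t) ∷ v) φ =
    trans (pair-++ (scale a (f t)) (lin f v) φ) (+-cong (pair-scale a (f t) φ) (pair-lin f v φ))

  coeff≈pair : ∀ v s → coeff v s ≈ pair v (λ t → ι (χ (t ≅ᵇ s)))
  coeff≈pair []            s = refl
  coeff≈pair ((a , t) ∷ v) s = +-cong (indicator (t ≅ᵇ s)) (coeff≈pair v s)
    where
    indicator : ∀ b → (if b then a else 0#) ≈ a * ι (χ b)
    indicator true  = sym (trans (*-congˡ (×-homo-1 1#)) (*-identityʳ a))
    indicator false = sym (zeroʳ a)

  coeff-lin : ∀ f v s → coeff (lin f v) s ≈ pair v (λ t → coeff (f t) s)
  coeff-lin f v s = begin
    coeff (lin f v) s                 ≈⟨ coeff≈pair (lin f v) s ⟩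
    pair (lin f v) δ                  ≈⟨ pair-lin f v δ ⟩
    pair v (λ t → pair (f t) δ)       ≈⟨ pair-cong v (λ t → coeff≈pair (f t) s) ⟨
    pair v (λ t → coeff (f t) s)      ∎
    where δ = λ u → ι (χ (u ≅ᵇ s))

  coeff-lin∘lin : ∀ g f v s → coeff (lin g (lin f v)) s ≈ pair v (λ t → coeff (lin g (f t)) s)
  coeff-lin∘lin g f v s = begin
    coeff (lin g (lin f v)) s                              ≈⟨ coeff-lin g (lin f v) s ⟩
    pair (lin f v) (λ u → coeff (g u) s)                   ≈⟨ pair-lin f v _ ⟩
    pair v (λ t → pair (f t) (λ u → coeff (g u) s))        ≈⟨ pair-cong v (λ t → coeff-lin g (f t) s) ⟨
    pair v (λ t → coeff (lin g (f t)) s)                   ∎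

  coeff-−V : ∀ v w s → coeff (v −V w) s ≈ coeff v s - coeff w s
  coeff-−V v w s = begin
    coeff (v ++ scale (- 1#) w) s         ≈⟨ coeff≈pair (v ++ scale (- 1#) w) s ⟩
    pair (v ++ scale (- 1#) w) δ          ≈⟨ pair-++ v (scale (- 1#) w) δ ⟩
    pair v δ + pair (scale (- 1#) w) δ    ≈⟨ +-congˡ (trans (pair-scale (- 1#) w δ) (-1*x≈-x _)) ⟩
    pair v δ - pair w δ                   ≈⟨ +-cong (coeff≈pair v s) (-‿cong (coeff≈pair w s)) ⟨
    coeff v s - coeff w s                 ∎
    where δ = λ t → ι (χ (t ≅ᵇ s))

  formalSum : List Tree → V
  formalSum L = map (λ c → (ι (countᵇ (λ u → u ≅ᵇ c) L) , c)) (deduplicateᵇ _≅ᵇ_ L)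

  pruneT≡formalSum : ∀ t → pruneT t ≡.≡ formalSum (prunes t)
  pruneT≡formalSum (node [])      = ≡.refl
  pruneT≡formalSum (node (_ ∷ _)) = ≡.refl

  pair-formalSum : ∀ L (n : Tree → ℕ) → (∀ {s t} → s ≃ t → n s ≡.≡ n t) →
                   ∀ {φ} → (∀ t → φ t ≈ ι (n t)) → pair (formalSum L) φ ≈ ι (∑ n L)
  pair-formalSum L n n-cong {φ} φ≈ιn = begin
    pair (formalSum L) φ                  ≈⟨ pair-classes (deduplicateᵇ _≅ᵇ_ L) ⟩
    ι (∑ (λ c → count c ℕ.* n c) (deduplicateᵇ _≅ᵇ_ L))
      ≡⟨ ≡.cong ι (∑-deduplicateᵇ _≅ᵇ_ ≅ᵇ-isEquivalence n (λ {s} {t} → n-cong ∘ mk≃ ∘ ≅ᵇ⇒≅ s t) L) ⟩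
    ι (∑ n L)                             ∎
    where
    count = λ c → countᵇ (λ u → u ≅ᵇ c) L
    pair-classes : ∀ D → pair (map (λ c → (ι (count c) , c)) D) φ ≈ ι (∑ (λ c → count c ℕ.* n c) D)
    pair-classes []      = refl
    pair-classes (c ∷ D) =
      trans (+-cong (trans (*-congˡ (φ≈ιn c)) (sym (×1-homo-* (count c) (n c)))) (pair-classes D))
            (sym (×-homo-+ 1# (count c ℕ.* n c) _))

  multiplicity : Tree → List Tree → ℕ
  multiplicity s = ∑ (λ u → χ (u ≅ᵇ s))

  χ-≅ᵇ-congˡ : ∀ s {t u} → t ≃ u → χ (t ≅ᵇ s) ≡.≡ χ (u ≅ᵇ s)
  χ-≅ᵇ-congˡ s (mk≃ t≅u) = ≡.cong (λ c → χ (c ==T canon s)) t≅u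

  coeff-formalSum : ∀ L s → coeff (formalSum L) s ≈ ι (multiplicity s L)
  coeff-formalSum L s =
    trans (coeff≈pair (formalSum L) s)
          (pair-formalSum L (λ u → χ (u ≅ᵇ s)) (χ-≅ᵇ-congˡ s) (λ _ → refl))

  coeff-𝔓∘growT : ∀ t s → coeff (𝔓 (growT t)) s ≈ ι (∑ (multiplicity s ∘ prunes) (grafts t))
  coeff-𝔓∘growT t s =
    trans (coeff-lin pruneT (growT t) s)
          (pair-formalSum (grafts t) (multiplicity s ∘ prunes) (∑-cong-≃ₘ (χ-≅ᵇ-congˡ s) ∘ prunes-cong)
                          coeff-pruneT)
    where
    coeff-pruneT : ∀ u → coeff (pruneT u) s ≈ ι (multiplicity s (prunes u))
    coeff-pruneT u =
      trans (reflexive (≡.cong (λ w → coeff w s) (pruneT≡formalSum u))) (coeff-formalSum (prunes u) s)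

  coeff-𝔑∘pruneT : ∀ t s → coeff (𝔑 (pruneT t)) s ≈ ι (∑ (multiplicity s ∘ grafts) (prunes t))
  coeff-𝔑∘pruneT t s = begin
    coeff (𝔑 (pruneT t)) s
      ≈⟨ coeff-lin growT (pruneT t) s ⟩
    pair (pruneT t) (λ u → coeff (growT u) s)
      ≡⟨ ≡.cong (λ w → pair w (λ u → coeff (growT u) s)) (pruneT≡formalSum t) ⟩
    pair (formalSum (prunes t)) (λ u → coeff (growT u) s)
      ≈⟨ pair-formalSum (prunes t) (multiplicity s ∘ grafts)
                        (∑-cong-≃ₘ (χ-≅ᵇ-congˡ s) ∘ grafts-cong)
                        (λ u → coeff-formalSum (grafts u) s) ⟩
    ι (∑ (multiplicity s ∘ grafts) (prunes t)) ∎

  coeff-degT : ∀ t s → coeff (degT t) s ≈ ι (size t ℕ.* χ (t ≅ᵇ s))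
  coeff-degT t s = trans (+-identityʳ _) (indicator (t ≅ᵇ s))
    where
    indicator : ∀ b → (if b then ι (size t) else 0#) ≈ ι (size t ℕ.* χ b)
    indicator true  = reflexive (≡.cong ι (≡.sym (ℕ.*-identityʳ (size t))))
    indicator false = reflexive (≡.cong ι (≡.sym (ℕ.*-zeroʳ (size t))))

  coeff-𝔓∘growT-split : ∀ t s → coeff (𝔓 (growT t)) s ≈ coeff (𝔑 (pruneT t)) s + coeff (degT t) s
  coeff-𝔓∘growT-split t s = begin
    coeff (𝔓 (growT t)) s
      ≈⟨ coeff-𝔓∘growT t s ⟩
    ι (∑ (multiplicity s ∘ prunes) (grafts t))
      ≡⟨ ≡.cong ι (∑-prunes∘grafts (λ u → χ (u ≅ᵇ s)) t) ⟩
    ι (deg ℕ.+ ∑ (multiplicity s ∘ grafts) (prunes t))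
      ≡⟨ ≡.cong ι (ℕ.+-comm deg _) ⟩
    ι (∑ (multiplicity s ∘ grafts) (prunes t) ℕ.+ deg)
      ≈⟨ ×-homo-+ 1# (∑ (multiplicity s ∘ grafts) (prunes t)) deg ⟩
    ι (∑ (multiplicity s ∘ grafts) (prunes t)) + ι deg
      ≈⟨ +-cong (coeff-𝔑∘pruneT t s) (coeff-degT t s) ⟨
    coeff (𝔑 (pruneT t)) s + coeff (degT t) s ∎
    where deg = size t ℕ.* χ (t ≅ᵇ s)

  commutator : ∀ v → 𝔓 (𝔑 v) −V 𝔑 (𝔓 v) ≈V 𝔇 v
  commutator v s = begin
    coeff (𝔓 (𝔑 v) −V 𝔑 (𝔓 v)) s
      ≈⟨ coeff-−V (𝔓 (𝔑 v)) (𝔑 (𝔓 v)) s ⟩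
    coeff (𝔓 (𝔑 v)) s - coeff (𝔑 (𝔓 v)) s
      ≈⟨ +-cong (coeff-lin∘lin pruneT growT v s) (-‿cong (coeff-lin∘lin growT pruneT v s)) ⟩
    pair v (λ t → coeff (𝔓 (growT t)) s) - pair v 𝔑𝔓
      ≈⟨ +-congʳ (trans (pair-cong v (λ t → coeff-𝔓∘growT-split t s)) (pair-+ v 𝔑𝔓 _)) ⟩
    (pair v 𝔑𝔓 + pair v (λ t → coeff (degT t) s)) - pair v 𝔑𝔓
      ≈⟨ xyx⁻¹≈y (pair v 𝔑𝔓) _ ⟩
    pair v (λ t → coeff (degT t) s)
      ≈⟨ coeff-lin degT v s ⟨
    coeff (𝔇 v) s ∎
    where 𝔑𝔓 = λ t → coeff (𝔑 (pruneT t)) s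

proposition2p2 : ∀ {c ℓ} (k : Field c ℓ) → Char0 k →
                   let open Vec k in
                   ∀ v → 𝔓 (𝔑 v) −V 𝔑 (𝔓 v) ≈V 𝔇 v
proposition2p2 k _ = Operators.commutator k
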